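{- Let $m$ and $k$ be positive integers with $m > k$, and let $A \in \mathcal A_k$. Then the collection of numerical semigroups with multiplicity $m$ and type $(A; k)$ is exactly the collection of sets of the form (a disjoint union) \[ \Lambda = \{0\} \cup (m + A) \cup \big(2m + (A + A)\cap[0, k]\big) \cup B \cup [2m + k + 1, \infty) \] where $B$ is any subset of $[m+k+1, 2m+k-1] \setminus (2m + A + A)$.
   Context: A numerical semigroup is a subset $\Lambda\subset\mathbb{N}_0$ closed under addition, containing $0$, with finite complement in $\mathbb{N}_0$; its multiplicity $m(\Lambda)$ is its smallest nonzero element and its Frobenius number $f(\Lambda)$ is the largest element of $\mathbb{N}_0\setminus\Lambda$. For integers $a\le b$, $[a,b]=\{a,\dots,b\}$, $[a,\infty)=\{a,a+1,\dots\}$. For $A\subset\mathbb{Z}$ and $b\in\mathbb{Z}$, $A+A=\{a_1+a_2: a_1,a_2\in A\}$ and $b+A=A+b=\{a+b:a\in A\}$. For a positive integer $k$, $\mathcal A_k=\{A\subset[0,k-1]: 0\in A \text{ and } k\notin A+A\}$. A numerical semigroup $\Lambda$ with multiplicity $m$ and Frobenius number $f$ satisfying $2m<f<3m$ has type $(A;k)$, where $k<m$ is a positive integer and $A\in\mathcal A_k$, if $f=2m+k$ and $\Lambda\cap[m,m+k]=A+m$. -}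

module Defs where

open import Data.Nat using (ℕ; _+_; _*_; _∸_; _≤_; _<_)
open import Data.Bool using (Bool; true)
open import Data.Product using (_×_; ∃; ∃-syntax)
open import Data.Sum using (_⊎_)
open import Relation.Nullary using (¬_)
open import Relation.Binary.PropositionalEquality using (_≡_)
open import Function.Bundles using (_⇔_)

SubsetN : Set
SubsetN = ℕ → Bool

infix 4 _∈_ _∉_
_∈_ : ℕ → SubsetN → Set
x ∈ S = S x ≡ true

_∉_ : ℕ → SubsetN → Set
x ∉ S = ¬ (x ∈ S)

record IsNumericalSemigroup (Λ : SubsetN) : Set where
  field
    zero∈    : 0 ∈ Λ
    closed   : ∀ x y → x ∈ Λ → y ∈ Λ → x + y ∈ Λ
    cofinite : ∃[ N ] (∀ n → N ≤ n → n ∈ Λ)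

IsMultiplicity : SubsetN → ℕ → Set
IsMultiplicity Λ m = (0 < m) × (m ∈ Λ) × (∀ n → 0 < n → n < m → n ∉ Λ)

IsFrobenius : SubsetN → ℕ → Set
IsFrobenius Λ f = (f ∉ Λ) × (∀ n → f < n → n ∈ Λ)

InSumset : SubsetN → ℕ → Set
InSumset A n = ∃[ a₁ ] ∃[ a₂ ] (a₁ ∈ A × a₂ ∈ A × a₁ + a₂ ≡ n)

InCalA : ℕ → SubsetN → Set
InCalA k A = (∀ a → a ∈ A → a < k) × (0 ∈ A) × ¬ InSumset A k

HasType : SubsetN → ℕ → SubsetN → ℕ → Set
HasType Λ m A k =
  (0 < k) × (k < m) × InCalA k A × IsFrobenius Λ (2 * m + k) ×
  (∀ x → m ≤ x → x ≤ m + k → (x ∈ Λ ⇔ (∃[ a ] (a ∈ A × x ≡ m + a))))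

InUnion : ℕ → ℕ → SubsetN → SubsetN → ℕ → Set
InUnion m k A B x =
  (x ≡ 0)
  ⊎ (∃[ a ] (a ∈ A × x ≡ m + a))
  ⊎ (∃[ s ] (InSumset A s × s ≤ k × x ≡ 2 * m + s))
  ⊎ (x ∈ B)
  ⊎ (2 * m + k + 1 ≤ x)

AdmissibleB : ℕ → ℕ → SubsetN → SubsetN → Set
AdmissibleB m k A B =
  ∀ x → x ∈ B →
    (m + k + 1 ≤ x) × (x ≤ 2 * m + k ∸ 1) × ¬ (∃[ s ] (InSumset A s × x ≡ 2 * m + s))

-- Below the Frobenius number f = 2m + k < 3m, the nonzero elements of Λ lie in [m, 2m + k). A sum
-- of two of them lies above f unless both summands lie in the window [m, m + k], where Λ agrees
-- with m + A; their sums then fill 2m + (A + A), and k ∉ A + A is exactly what keeps f out of Λ.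
-- Hence Λ is forced on [0, m + k] and on 2m + (A + A), while every other point of (m + k, f) may
-- be chosen freely: these free choices are the sets B.
module Submission where

open import Defs
open import Data.Bool using (true)
import Data.Bool.Properties as Bool
open import Data.Empty using (⊥-elim)
open import Data.Nat
  using (ℕ; zero; suc; _+_; _*_; _∸_; _≤_; _<_; s≤s; s≤s⁻¹; z<s; _≤?_; _<?_; _≟_)
open import Data.Nat.Properties
open import Data.Nat.Tactic.RingSolver using (solve-∀)
open import Data.Product using (_×_; _,_; proj₁; proj₂; ∃-syntax)
open import Data.Sum using (inj₁; inj₂)
open import Function.Base using (_∘_)
open import Function.Bundles using (_⇔_; mk⇔; Equivalence)
open import Relation.Nullary using (¬_; Dec; yes; no; does)
open import Relation.Nullary.Decidable using (map′; _×-dec_; ¬?)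
open import Relation.Unary using (Decidable)
open import Relation.Binary.PropositionalEquality using (_≡_; refl; sym; trans; cong; subst)

open Equivalence using (to; from)

infix 4 _∈?_
_∈?_ : (x : ℕ) (S : SubsetN) → Dec (x ∈ S)
x ∈? S = S x Bool.≟ true

⟦_⟧ : {P : ℕ → Set} → Decidable P → SubsetN
⟦ P? ⟧ x = does (P? x)

∈⟦⟧⇔ : {P : ℕ → Set} (P? : Decidable P) {x : ℕ} → x ∈ ⟦ P? ⟧ ⇔ P x
∈⟦⟧⇔ P? {x} with P? x
... | yes p = mk⇔ (λ _ → p) (λ _ → refl)
... | no ¬p = mk⇔ (λ ()) (⊥-elim ∘ ¬p)

Shifted : (ℕ → Set) → ℕ → ℕ → Set
Shifted P c x = ∃[ s ] (P s × x ≡ c + s)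

shifted? : {P : ℕ → Set} → Decidable P → (c : ℕ) → Decidable (Shifted P c)
shifted? {P} P? c x with c ≤? x
... | no c≰x = no λ (s , _ , x≡c+s) → c≰x (subst (c ≤_) (sym x≡c+s) (m≤m+n c s))
... | yes c≤x = map′ (λ p → x ∸ c , p , sym (m+[n∸m]≡n c≤x)) unshift (P? (x ∸ c))
  where
  unshift : Shifted P c x → P (x ∸ c)
  unshift (s , p , x≡c+s) = subst P (sym (trans (cong (_∸ c) x≡c+s) (m+n∸m≡n c s))) p

inSumset? : (A : SubsetN) → Decidable (InSumset A)
inSumset? A s = map′ split merge (anyUpTo? (λ a → (a ∈? A) ×-dec (s ∸ a ∈? A)) (suc s))
  where
  split : ∃[ a ] (a < suc s × a ∈ A × s ∸ a ∈ A) → InSumset A s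
  split (a , a<1+s , a∈A , s∸a∈A) = a , s ∸ a , a∈A , s∸a∈A , m+[n∸m]≡n (s≤s⁻¹ a<1+s)

  merge : InSumset A s → ∃[ a ] (a < suc s × a ∈ A × s ∸ a ∈ A)
  merge (a , b , a∈A , b∈A , a+b≡s) =
    a , s≤s (subst (a ≤_) a+b≡s (m≤m+n a b)) , a∈A ,
    subst (_∈ A) (sym (trans (cong (_∸ a) (sym a+b≡s)) (m+n∸m≡n a b))) b∈A

<⇒+1≤ : ∀ {m n} → m < n → m + 1 ≤ n
<⇒+1≤ {m} {n} = subst (_≤ n) (+-comm 1 m)

+1≤⇒< : ∀ {m n} → m + 1 ≤ n → m < n
+1≤⇒< {m} {n} = subst (_≤ n) (+-comm m 1)

<⇒≤∸1 : ∀ {m n} → m < n → m ≤ n ∸ 1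
<⇒≤∸1 (s≤s m≤n) = m≤n

≤∸1⇒< : ∀ {m n} → 0 < n → m ≤ n ∸ 1 → m < n
≤∸1⇒< {n = suc _} _ m≤n = s≤s m≤n

+-cancelˡ-≤∸1 : ∀ n {s k} → n + s ≤ n + k ∸ 1 → s ≤ k
+-cancelˡ-≤∸1 n {s} {k} le = +-cancelˡ-≤ n s k (≤-trans le (m∸n≤m (n + k) 1))

<⇒+-+1≤ : ∀ n {k s} → k < s → n + k + 1 ≤ n + s
<⇒+-+1≤ n {k} {s} k<s = subst (_≤ n + s) (sym (+-assoc n k 1)) (+-monoʳ-≤ n (<⇒+1≤ k<s))

m≤m+k+1 : ∀ m k → m ≤ m + k + 1
m≤m+k+1 m k = ≤-trans (m≤m+n m k) (m≤m+n (m + k) 1)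

m+k+1≤2m+s : ∀ {m k} s → k < m → m + k + 1 ≤ 2 * m + s
m+k+1≤2m+s {m} {k} s k<m = begin
  m + k + 1     ≤⟨ <⇒+1≤ (+-monoʳ-< m k<m) ⟩
  m + m         ≤⟨ +-monoʳ-≤ m (m≤m+n m 0) ⟩
  2 * m         ≤⟨ m≤m+n (2 * m) s ⟩
  2 * m + s     ∎
  where open ≤-Reasoning

2m+k+1≡m+k+1+m : ∀ m k → 2 * m + k + 1 ≡ m + k + 1 + m
2m+k+1≡m+k+1+m = solve-∀

m+k+1≤2m+k+1 : ∀ m k → m + k + 1 ≤ 2 * m + k + 1
m+k+1≤2m+k+1 m k = subst (m + k + 1 ≤_) (sym (2m+k+1≡m+k+1+m m k)) (m≤m+n (m + k + 1) m)

2m+k+1≤x+y : ∀ {m k x y} → m + k + 1 ≤ x → m ≤ y → 2 * m + k + 1 ≤ x + y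
2m+k+1≤x+y {m} {k} {x} {y} x≥ y≥ =
  subst (_≤ x + y) (sym (2m+k+1≡m+k+1+m m k)) (+-mono-≤ x≥ y≥)

2m+k≡m+[m+k] : ∀ m k → 2 * m + k ≡ m + (m + k)
2m+k≡m+[m+k] = solve-∀

[m+a]+[m+b]≡2m+[a+b] : ∀ m a b → (m + a) + (m + b) ≡ 2 * m + (a + b)
[m+a]+[m+b]≡2m+[a+b] = solve-∀

pattern union-0 x≡0 = inj₁ x≡0
pattern union-m+A p = inj₂ (inj₁ p)
pattern union-2m+A+A p = inj₂ (inj₂ (inj₁ p))
pattern union-B x∈B = inj₂ (inj₂ (inj₂ (inj₁ x∈B)))
pattern union-tail x≥ = inj₂ (inj₂ (inj₂ (inj₂ x≥)))

Unconstrained : ℕ → ℕ → SubsetN → ℕ → Set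
Unconstrained m k A x =
  (m + k + 1 ≤ x) × (x ≤ 2 * m + k ∸ 1) × ¬ Shifted (InSumset A) (2 * m) x

unconstrained? : ∀ m k A → Decidable (Unconstrained m k A)
unconstrained? m k A x =
  (m + k + 1 ≤? x) ×-dec (x ≤? 2 * m + k ∸ 1) ×-dec ¬? (shifted? (inSumset? A) (2 * m) x)

data Region (m k x : ℕ) : Set where
  origin            : x ≡ 0 → Region m k x
  belowMultiplicity : 0 < x → x < m → Region m k x
  window            : m ≤ x → x ≤ m + k → Region m k x
  gap               : m + k + 1 ≤ x → x ≤ 2 * m + k ∸ 1 → Region m k x
  frobenius         : x ≡ 2 * m + k → Region m k x
  tail              : 2 * m + k + 1 ≤ x → Region m k x

region : ∀ m k x → Region m k x
region m k zero = origin refl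
region m k x@(suc _) with x <? m | x ≤? m + k | 2 * m + k <? x | x ≟ 2 * m + k
... | yes x<m | _         | _       | _       = belowMultiplicity z<s x<m
... | no x≮m  | yes x≤m+k | _       | _       = window (≮⇒≥ x≮m) x≤m+k
... | no _    | no _      | yes f<x | _       = tail (<⇒+1≤ f<x)
... | no _    | no _      | no _    | yes x≡f = frobenius x≡f
... | no _    | no x≰m+k  | no f≮x  | no x≢f  =
  gap (<⇒+1≤ (≰⇒> x≰m+k)) (<⇒≤∸1 (≤∧≢⇒< (≮⇒≥ f≮x) x≢f))

module FromType {m k : ℕ} {A Λ : SubsetN}
  (Λ-ns : IsNumericalSemigroup Λ)
  (A<k : ∀ a → a ∈ A → a < k)
  (Λ-multiplicity : ∀ n → 0 < n → n < m → n ∉ Λ)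
  (Λ-frobenius : IsFrobenius Λ (2 * m + k))
  (window⇔m+A : ∀ x → m ≤ x → x ≤ m + k → (x ∈ Λ ⇔ (∃[ a ] (a ∈ A × x ≡ m + a))))
  where

  open IsNumericalSemigroup Λ-ns

  m+A⊆Λ : ∀ {a} → a ∈ A → m + a ∈ Λ
  m+A⊆Λ {a} a∈A =
    from (window⇔m+A (m + a) (m≤m+n m a) (+-monoʳ-≤ m (<⇒≤ (A<k a a∈A)))) (a , a∈A , refl)

  2m+[A+A]⊆Λ : ∀ {s} → InSumset A s → 2 * m + s ∈ Λ
  2m+[A+A]⊆Λ (a , b , a∈A , b∈A , refl) =
    subst (_∈ Λ) ([m+a]+[m+b]≡2m+[a+b] m a b) (closed _ _ (m+A⊆Λ a∈A) (m+A⊆Λ b∈A))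

  Λ∩unconstrained? : Decidable (λ x → x ∈ Λ × Unconstrained m k A x)
  Λ∩unconstrained? x = (x ∈? Λ) ×-dec unconstrained? m k A x

  B : SubsetN
  B = ⟦ Λ∩unconstrained? ⟧

  B-admissible : AdmissibleB m k A B
  B-admissible x x∈B = proj₂ (to (∈⟦⟧⇔ Λ∩unconstrained?) x∈B)

  Λ⊆union : ∀ x → x ∈ Λ → InUnion m k A B x
  Λ⊆union x x∈Λ with region m k x
  ... | origin x≡0 = union-0 x≡0
  ... | belowMultiplicity 0<x x<m = ⊥-elim (Λ-multiplicity x 0<x x<m x∈Λ)
  ... | window m≤x x≤m+k = union-m+A (to (window⇔m+A x m≤x x≤m+k) x∈Λ)
  ... | frobenius refl = ⊥-elim (proj₁ Λ-frobenius x∈Λ)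
  ... | tail x≥ = union-tail x≥
  ... | gap x≥ x≤ = fromGap (shifted? (inSumset? A) (2 * m) x)
    where
    fromGap : Dec (Shifted (InSumset A) (2 * m) x) → InUnion m k A B x
    fromGap (yes (s , s∈A+A , x≡2m+s)) =
      union-2m+A+A
        (s , s∈A+A , +-cancelˡ-≤∸1 (2 * m) (subst (_≤ 2 * m + k ∸ 1) x≡2m+s x≤) , x≡2m+s)
    fromGap (no x∉2m+A+A) =
      union-B (from (∈⟦⟧⇔ Λ∩unconstrained?) (x∈Λ , x≥ , x≤ , x∉2m+A+A))

  union⊆Λ : ∀ x → InUnion m k A B x → x ∈ Λ
  union⊆Λ x (union-0 refl) = zero∈
  union⊆Λ x (union-m+A (a , a∈A , refl)) = m+A⊆Λ a∈A
  union⊆Λ x (union-2m+A+A (s , s∈A+A , _ , refl)) = 2m+[A+A]⊆Λ s∈A+A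
  union⊆Λ x (union-B x∈B) = proj₁ (to (∈⟦⟧⇔ Λ∩unconstrained?) x∈B)
  union⊆Λ x (union-tail x≥) = proj₂ Λ-frobenius x (+1≤⇒< x≥)

  Λ⇔union : ∀ x → x ∈ Λ ⇔ InUnion m k A B x
  Λ⇔union x = mk⇔ (Λ⊆union x) (union⊆Λ x)

-- The coarsening of InUnion that closure under + needs: 2m + (A + A), B and the tail lie above m + k.
data Piece (m k : ℕ) (A : SubsetN) (x : ℕ) : Set where
  origin : x ≡ 0 → Piece m k A x
  window : ∀ a → a ∈ A → x ≡ m + a → Piece m k A x
  high   : m + k + 1 ≤ x → Piece m k A x

module FromUnion {m k : ℕ} {A B Λ : SubsetN}
  (0<k : 0 < k) (k<m : k < m)
  (A<k : ∀ a → a ∈ A → a < k) (0∈A : 0 ∈ A) (k∉A+A : ¬ InSumset A k)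
  (B-admissible : AdmissibleB m k A B)
  (Λ⇔union : ∀ x → x ∈ Λ ⇔ InUnion m k A B x)
  where

  0<m : 0 < m
  0<m = <-trans 0<k k<m

  piece : ∀ {x} → x ∈ Λ → Piece m k A x
  piece {x} x∈Λ with to (Λ⇔union x) x∈Λ
  ... | union-0 x≡0 = origin x≡0
  ... | union-m+A (a , a∈A , x≡m+a) = window a a∈A x≡m+a
  ... | union-2m+A+A (s , _ , _ , x≡2m+s) =
    high (subst (m + k + 1 ≤_) (sym x≡2m+s) (m+k+1≤2m+s s k<m))
  ... | union-B x∈B = high (proj₁ (B-admissible x x∈B))
  ... | union-tail x≥ = high (≤-trans (m+k+1≤2m+k+1 m k) x≥)

  tail⊆Λ : ∀ {x} → 2 * m + k + 1 ≤ x → x ∈ Λ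
  tail⊆Λ {x} x≥ = from (Λ⇔union x) (union-tail x≥)

  window+window∈Λ : ∀ {a b} → a ∈ A → b ∈ A → (m + a) + (m + b) ∈ Λ
  window+window∈Λ {a} {b} a∈A b∈A =
    subst (_∈ Λ) (sym ([m+a]+[m+b]≡2m+[a+b] m a b)) 2m+[a+b]∈Λ
    where
    2m+[a+b]∈Λ : 2 * m + (a + b) ∈ Λ
    2m+[a+b]∈Λ with a + b ≤? k
    ... | yes a+b≤k =
      from (Λ⇔union _) (union-2m+A+A (a + b , (a , b , a∈A , b∈A , refl) , a+b≤k , refl))
    ... | no a+b≰k = tail⊆Λ (<⇒+-+1≤ (2 * m) (≰⇒> a+b≰k))

  +-closed : ∀ x y → x ∈ Λ → y ∈ Λ → x + y ∈ Λ
  +-closed x y x∈Λ y∈Λ with piece x∈Λ | piece y∈Λ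
  ... | origin refl       | _                 = y∈Λ
  ... | _                 | origin refl       = subst (_∈ Λ) (sym (+-identityʳ x)) x∈Λ
  ... | window a a∈A refl | window b b∈A refl = window+window∈Λ a∈A b∈A
  ... | window a _ refl   | high y≥           =
    tail⊆Λ (subst (2 * m + k + 1 ≤_) (+-comm y x) (2m+k+1≤x+y y≥ (m≤m+n m a)))
  ... | high x≥           | window b _ refl   = tail⊆Λ (2m+k+1≤x+y x≥ (m≤m+n m b))
  ... | high x≥           | high y≥           = tail⊆Λ (2m+k+1≤x+y x≥ (≤-trans (m≤m+k+1 m k) y≥))

  isNumericalSemigroup : IsNumericalSemigroup Λ
  isNumericalSemigroup = record
    { zero∈    = from (Λ⇔union 0) (union-0 refl)
    ; closed   = +-closed
    ; cofinite = 2 * m + k + 1 , λ _ → tail⊆Λ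
    }

  isMultiplicity : IsMultiplicity Λ m
  isMultiplicity =
    0<m , from (Λ⇔union m) (union-m+A (0 , 0∈A , sym (+-identityʳ m))) , below-m∉Λ
    where
    below-m∉Λ : ∀ n → 0 < n → n < m → n ∉ Λ
    below-m∉Λ n 0<n n<m n∈Λ with piece n∈Λ
    ... | origin refl = <-irrefl refl 0<n
    ... | window a _ refl = <⇒≱ n<m (m≤m+n m a)
    ... | high n≥ = <⇒≱ n<m (≤-trans (m≤m+k+1 m k) n≥)

  isFrobenius : IsFrobenius Λ (2 * m + k)
  isFrobenius = f∉Λ , λ n f<n → tail⊆Λ (<⇒+1≤ f<n)
    where
    0<f : 0 < 2 * m + k
    0<f = ≤-trans 0<k (m≤n+m k (2 * m))

    f∉Λ : 2 * m + k ∉ Λ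
    f∉Λ f∈Λ with to (Λ⇔union _) f∈Λ
    ... | union-0 f≡0 = <-irrefl (sym f≡0) 0<f
    ... | union-m+A (a , a∈A , f≡m+a) =
      <⇒≱ (A<k a a∈A) (subst (k ≤_) m+k≡a (m≤n+m k m))
      where
      m+k≡a : m + k ≡ a
      m+k≡a = +-cancelˡ-≡ m (m + k) a (trans (sym (2m+k≡m+[m+k] m k)) f≡m+a)
    ... | union-2m+A+A (s , s∈A+A , _ , f≡2m+s) =
      k∉A+A (subst (InSumset A) (sym (+-cancelˡ-≡ (2 * m) k s f≡2m+s)) s∈A+A)
    ... | union-B f∈B = <-irrefl refl (≤∸1⇒< 0<f (proj₁ (proj₂ (B-admissible _ f∈B))))
    ... | union-tail f≥ = <-irrefl refl (+1≤⇒< f≥)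

  window⇔m+A : ∀ x → m ≤ x → x ≤ m + k → (x ∈ Λ ⇔ (∃[ a ] (a ∈ A × x ≡ m + a)))
  window⇔m+A x m≤x x≤m+k = mk⇔ (fromPiece ∘ piece) (from (Λ⇔union x) ∘ union-m+A)
    where
    fromPiece : Piece m k A x → ∃[ a ] (a ∈ A × x ≡ m + a)
    fromPiece (origin refl) = ⊥-elim (<⇒≱ 0<m m≤x)
    fromPiece (window a a∈A x≡m+a) = a , a∈A , x≡m+a
    fromPiece (high x≥) = ⊥-elim (<⇒≱ (+1≤⇒< x≥) x≤m+k)

proposition3p3 : (m k : ℕ) → 0 < k → k < m → (A : SubsetN) → InCalA k A →
    (Λ : SubsetN) →
      ((IsNumericalSemigroup Λ × IsMultiplicity Λ m × HasType Λ m A k)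
        ⇔ (∃[ B ] (AdmissibleB m k A B × (∀ x → (x ∈ Λ ⇔ InUnion m k A B x)))))
proposition3p3 m k 0<k k<m A A∈𝒜@(A<k , 0∈A , k∉A+A) Λ = mk⇔
  (λ (Λ-ns , (_ , _ , Λ-multiplicity) , (_ , _ , _ , Λ-frobenius , window⇔m+A)) →
    let open FromType Λ-ns A<k Λ-multiplicity Λ-frobenius window⇔m+A
    in B , B-admissible , Λ⇔union)
  (λ (B , B-admissible , Λ⇔union) →
    let open FromUnion 0<k k<m A<k 0∈A k∉A+A B-admissible Λ⇔union
    in isNumericalSemigroup , isMultiplicity , (0<k , k<m , A∈𝒜 , isFrobenius , window⇔m+A))
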